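{- Let $K$ be a finite simplicial complex, let $\overrightarrow{W}$ be a Morse sequence on $K$, and let $\Upsilon$ be its Morse reference. Then for each $p\ge 0$ and each $c\in K[p]$, we have $d_p(\Upsilon(c))=\Upsilon(\partial_p(c))$.
   Context: A finite simplicial complex $K$ is a finite family of non-empty finite sets such that $\sigma\in K$ whenever $\emptyset\neq\sigma\subseteq\tau$ for some $\tau\in K$; $K^{(p)}$ is the set of $p$-simplexes (sets of $p+1$ elements), and a facet is an inclusion-maximal simplex. For $p\ge -1$, $K[p]$ is the set of all subsets of $K^{(p)}$ (with $K^{(-1)}=\emptyset$, so $K[-1]=\{\emptyset\}$), a $\mathbb{Z}_2$-vector space under symmetric difference, the empty chain being $0$. For $\sigma\in K^{(p)}$, $\partial(\sigma)=\{\tau\in K^{(p-1)}:\tau\subset\sigma\}$; the boundary operator $\partial_p:K[p]\to K[p-1]$ is $\partial_p(c)=\sum_{\sigma\in c}\partial(\sigma)$ (mod 2), $\partial_p(\emptyset)=0$. A pair $(\sigma,\tau)$ with $\sigma\in K^{(p)},\tau\in K^{(p+1)}$ is free for $K$ if $\tau$ is the only simplex of $K$ strictly containing $\sigma$; then $K$ is an elementary expansion of $K\setminus\{\sigma,\tau\}$. If $\sigma$ is a facet of $K$, $K$ is an elementary filling of $K\setminus\{\sigma\}$. A Morse sequence on $K$ is a sequence $\langle\emptyset=K_0,\dots,K_k=K\rangle$ where each $K_i$ is an elementary expansion or elementary filling of $K_{i-1}$; a simplex added by a filling is critical, and a free pair $(\sigma,\tau)$ added by an expansion is a regular pair. $\ddot{W}^{(p)}$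 is the set of critical $p$-simplexes ($\ddot{W}^{(-1)}=\emptyset$) and $\ddot{W}[p]$ the set of its subsets, a subspace of $K[p]$. A Morse frame is a map $\Upsilon$ sending each $\sigma\in K^{(p)}$ to $\Upsilon(\sigma)\in\ddot{W}[p]$, extended to chains by $\Upsilon(c)=\sum_{\sigma\in c}\Upsilon(\sigma)$ (mod 2), $\Upsilon(\emptyset)=0$. The Morse reference $\Upsilon$ is the unique frame with $\Upsilon(\sigma)=\{\sigma\}$ for critical $\sigma$ and, for each regular pair $(\sigma,\tau)$, $\Upsilon(\tau)=0$ and $\Upsilon(\sigma)=\Upsilon(\partial(\tau)\setminus\{\sigma\})$. For a critical $p$-simplex $\sigma$, set $d(\sigma)=\Upsilon(\partial(\sigma))$, and define $d_p:\ddot{W}[p]\to\ddot{W}[p-1]$ by $d_p(c)=\Upsilon(\partial_p(c))=\sum_{\sigma\in c}d(\sigma)$, $d_p(\emptyset)=0$. -}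

module Defs where

open import Data.Nat using (ℕ; suc)
open import Data.Bool using (Bool; true; false; _∧_; _xor_; not)
open import Data.Bool.Properties using () renaming (_≟_ to _≟B_)
open import Data.List using (List; []; _∷_; _++_; foldr)
open import Data.List.Membership.Propositional using (_∈_; _∉_)
open import Data.List.Relation.Unary.Unique.Propositional using (Unique)
open import Data.Fin.Subset using (Subset; _⊆_; _⊂_; ∣_∣; Nonempty)
open import Data.Fin.Subset.Properties using (_⊆?_)
open import Data.Vec.Properties using (≡-dec)
open import Data.Product using (_×_)
open import Relation.Nullary using (¬_; Dec)
open import Relation.Nullary.Decidable using (⌊_⌋)
open import Relation.Binary.PropositionalEquality using (_≡_)
open import Relation.Binary.Definitions using (DecidableEquality)
import Data.List.Membership.DecPropositional as DecMem

-- Simplexes on the vertex set Fin n: non-empty subsets of Fin n.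
-- A p-simplex has p+1 elements:  ∣ σ ∣ ≡ suc p.

Simplex : ℕ → Set
Simplex n = Subset n

_≟S_ : ∀ {n} → DecidableEquality (Simplex n)
_≟S_ = ≡-dec _≟B_

_∈?_ : ∀ {n} (σ : Simplex n) (K : List (Simplex n)) → Dec (σ ∈ K)
_∈?_ = DecMem._∈?_ _≟S_

IsComplex : ∀ {n} → List (Simplex n) → Set
IsComplex K =
  Unique K
  × (∀ {σ} → σ ∈ K → Nonempty σ)
  × (∀ {σ τ} → τ ∈ K → Nonempty σ → σ ⊆ τ → σ ∈ K)

Free : ∀ {n} → List (Simplex n) → Simplex n → Simplex n → Set
Free K σ τ =
  σ ∈ K × τ ∈ K × ∣ τ ∣ ≡ suc ∣ σ ∣ × σ ⊂ τ
  × (∀ {ρ} → ρ ∈ K → σ ⊂ ρ → ρ ≡ τ)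

Facet : ∀ {n} → List (Simplex n) → Simplex n → Set
Facet K σ = σ ∈ K × (∀ {ρ} → ρ ∈ K → ¬ (σ ⊂ ρ))

data Step (n : ℕ) : Set where
  fill   : Simplex n → Step n
  expand : Simplex n → Simplex n → Step n

added : ∀ {n} → Step n → List (Simplex n)
added (fill σ)     = σ ∷ []
added (expand σ τ) = σ ∷ τ ∷ []

data ValidStep {n} (L : List (Simplex n)) : Step n → Set where
  fillOK   : ∀ {σ} → IsComplex (σ ∷ L) → σ ∉ L → Facet (σ ∷ L) σ
           → ValidStep L (fill σ)
  expandOK : ∀ {σ τ} → IsComplex (σ ∷ τ ∷ L) → σ ∉ L → τ ∉ L
           → Free (σ ∷ τ ∷ L) σ τ
           → ValidStep L (expand σ τ)

-- MorseSeq ss K : ss (listed latest step first) is a Morse sequence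
-- ⟨ ∅ = K₀ , … , K_k = K ⟩ ending in the complex K.
data MorseSeq {n} : List (Step n) → List (Simplex n) → Set where
  start : MorseSeq [] []
  step  : ∀ {ss L s} → IsComplex L → MorseSeq ss L → ValidStep L s
        → MorseSeq (s ∷ ss) (added s ++ L)

Critical : ∀ {n} → List (Step n) → Simplex n → Set
Critical ss σ = fill σ ∈ ss

RegularPair : ∀ {n} → List (Step n) → Simplex n → Simplex n → Set
RegularPair ss σ τ = expand σ τ ∈ ss

-- Chains over ℤ₂: a chain is (the characteristic function of) a set of
-- simplexes.  Equality of chains is extensional equality of sets.

Chain : ℕ → Set
Chain n = Simplex n → Bool

_≐_ : ∀ {n} → Chain n → Chain n → Set
c ≐ c′ = ∀ ρ → c ρ ≡ c′ ρ

zeroC : ∀ {n} → Chain n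
zeroC _ = false

singleton : ∀ {n} → Simplex n → Chain n
singleton σ ρ = ⌊ ρ ≟S σ ⌋

remove : ∀ {n} → Chain n → Simplex n → Chain n
remove c σ ρ = c ρ ∧ not ⌊ ρ ≟S σ ⌋

InChains : ∀ {n} → List (Simplex n) → ℕ → Chain n → Set
InChains K p c = ∀ σ → c σ ≡ true → σ ∈ K × ∣ σ ∣ ≡ suc p

-- Σ_{σ ∈ c} f(σ)  (mod 2), for a chain c of simplexes of K;
-- the sum runs over the (duplicate-free) enumeration K of the simplexes.
sumOver : ∀ {n} → List (Simplex n) → Chain n → (Simplex n → Chain n) → Chain n
sumOver K c f ρ = foldr (λ σ acc → (c σ ∧ f σ ρ) xor acc) false K

bd : ∀ {n} → List (Simplex n) → Simplex n → Chain n
bd K σ τ = ⌊ τ ∈? K ⌋ ∧ ⌊ suc ∣ τ ∣ Data.Nat.≟ ∣ σ ∣ ⌋ ∧ ⌊ τ ⊆? σ ⌋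

bdC : ∀ {n} → List (Simplex n) → Chain n → Chain n
bdC K c = sumOver K c (bd K)

extend : ∀ {n} → List (Simplex n) → (Simplex n → Chain n) → Chain n → Chain n
extend K Υ c = sumOver K c Υ

IsMorseFrame : ∀ {n} → List (Step n) → List (Simplex n) → (Simplex n → Chain n) → Set
IsMorseFrame ss K Υ =
  ∀ σ → σ ∈ K → ∀ ρ → Υ σ ρ ≡ true → Critical ss ρ × ∣ ρ ∣ ≡ ∣ σ ∣

IsMorseReference : ∀ {n} → List (Step n) → List (Simplex n) → (Simplex n → Chain n) → Set
IsMorseReference ss K Υ =
  IsMorseFrame ss K Υ
  × (∀ σ → Critical ss σ → Υ σ ≐ singleton σ)
  × (∀ σ τ → RegularPair ss σ τ →
       (Υ τ ≐ zeroC) × (Υ σ ≐ extend K Υ (remove (bd K τ) σ)))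

dMorse : ∀ {n} → List (Step n) → List (Simplex n) → (Simplex n → Chain n) → Chain n → Chain n
dMorse ss K Υ c = sumOver K c (λ σ → extend K Υ (bd K σ))

{-# OPTIONS --safe #-}
-- Both sides are linear in c, so it suffices to show d(Υ σ) = Υ(∂σ) for every simplex σ
-- of K, by induction along the Morse sequence. For a critical σ this is the definition of d.
-- For a regular pair (σ, τ) we have Υ τ = 0 = Υ σ + Υ(∂τ ∖ σ) = Υ(∂τ), and since the faces
-- in ∂τ ∖ σ were added earlier, Υ σ = Υ(∂τ ∖ σ) gives d(Υ σ) = Υ(∂(∂τ ∖ σ)) = Υ(∂σ) + Υ(∂∂τ).
-- Finally ∂∂τ = 0 over ℤ₂ because every codimension-two face of τ lies in exactly two
-- facets of τ: intervals of length two in a subset lattice are diamonds.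
module Submission where

open import Defs
import Algebra.Properties.CommutativeSemigroup as CommutativeSemigroupProperties
open import Algebra.Bundles using (CommutativeRing)
open import Data.Nat using (ℕ; suc; _≤_) renaming (_≟_ to _≟ℕ_)
open import Data.Nat.Properties using (suc-injective; 1+n≢n; <-irrefl)
open import Data.Bool using (Bool; true; false; _∧_; _xor_; not)
open import Data.Bool.Properties
  using (xor-same; xor-identityʳ; ∧-identityʳ; ∧-assoc; ∧-distribˡ-xor; ∧-distribʳ-xor;
         ¬-not; T-≡; xor-∧-commutativeRing)
open import Data.Empty using (⊥-elim)
open import Data.Fin.Subset using (Subset; inside; outside; _⊆_; ∣_∣; Nonempty)
open import Data.Fin.Subset.Properties using (_⊆?_; ⊆-refl; ⊆-trans; drop-∷-⊆; out⊆; in⊆in; p⊆q⇒∣p∣≤∣q∣)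
open import Data.List using (List; []; _∷_; foldr)
open import Data.List.Membership.Propositional using (_∈_)
open import Data.List.Relation.Unary.Any using (here; there)
import Data.List.Relation.Unary.All as All
open import Data.List.Relation.Unary.AllPairs using ([]; _∷_)
open import Data.List.Relation.Unary.Unique.Propositional using (Unique)
import Data.List.Relation.Binary.Subset.Propositional as List
open import Data.Product using (_×_; _,_; proj₁; proj₂)
import Data.Product as Product
open import Data.Sum using (_⊎_; inj₁; inj₂; [_,_])
import Data.Sum as Sum
open import Data.Vec using ([]; _∷_; here)
open import Data.Vec.Properties using (∷-injectiveʳ)
open import Function using (_∘_; id)
open import Function.Bundles using (Equivalence)
open import Relation.Binary.Definitions using (DecidableEquality)
open import Relation.Binary.PropositionalEquality hiding ([_])
open import Relation.Nullary using (Dec; yes; no; ¬_; _×-dec_)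
open import Relation.Nullary.Decidable using (⌊_⌋; isYes≗does; dec-true; dec-false; toWitness)

private
  variable
    A B : Set

module _ {P : Set} (P? : Dec P) where

  ⌊⌋≡true⇒ : ⌊ P? ⌋ ≡ true → P
  ⌊⌋≡true⇒ = toWitness ∘ Equivalence.from T-≡

  ⌊⌋-true : P → ⌊ P? ⌋ ≡ true
  ⌊⌋-true p = trans (isYes≗does P?) (dec-true P? p)

  ⌊⌋-false : ¬ P → ⌊ P? ⌋ ≡ false
  ⌊⌋-false ¬p = trans (isYes≗does P?) (dec-false P? ¬p)

  not⌊⌋≡true⇒ : not ⌊ P? ⌋ ≡ true → ¬ P
  not⌊⌋≡true⇒ e p with () ← trans (sym e) (cong not (⌊⌋-true p))

xor≡false⇒≡ : ∀ {a b} → a xor b ≡ false → a ≡ b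
xor≡false⇒≡ {false} {false} _ = refl
xor≡false⇒≡ {true}  {true}  _ = refl

∧≡true⇒ : ∀ {a b} → a ∧ b ≡ true → a ≡ true × b ≡ true
∧≡true⇒ {true} {true} _ = refl , refl

-- sumOver K c f ρ unfolds definitionally to xorSum K (λ σ → c σ ∧ f σ ρ).
xorSum : List A → (A → Bool) → Bool
xorSum L t = foldr (λ x acc → t x xor acc) false L

xorSum-cong : ∀ (L : List A) {t u} → (∀ {x} → x ∈ L → t x ≡ u x) → xorSum L t ≡ xorSum L u
xorSum-cong []      _   = refl
xorSum-cong (x ∷ L) t≡u = cong₂ _xor_ (t≡u (here refl)) (xorSum-cong L (t≡u ∘ there))

xorSum-false : ∀ (L : List A) {t} → (∀ {x} → x ∈ L → t x ≡ false) → xorSum L t ≡ false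
xorSum-false []      _      = refl
xorSum-false (x ∷ L) t≡false rewrite t≡false (here refl) = xorSum-false L (t≡false ∘ there)

xorSum-xor : ∀ (L : List A) (t u : A → Bool) → xorSum L (λ x → t x xor u x) ≡ xorSum L t xor xorSum L u
xorSum-xor []      t u = refl
xorSum-xor (x ∷ L) t u = trans (cong ((t x xor u x) xor_) (xorSum-xor L t u))
                               (interchange (t x) (u x) (xorSum L t) (xorSum L u))
  where
  open CommutativeSemigroupProperties (CommutativeRing.+-commutativeSemigroup xor-∧-commutativeRing)
    using (interchange)

xorSum-∧ʳ : ∀ (L : List A) (t : A → Bool) b → xorSum L (λ x → t x ∧ b) ≡ xorSum L t ∧ b
xorSum-∧ʳ []      t b = refl
xorSum-∧ʳ (x ∷ L) t b = trans (cong ((t x ∧ b) xor_) (xorSum-∧ʳ L t b))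
                              (sym (∧-distribʳ-xor b (t x) (xorSum L t)))

xorSum-∧ˡ : ∀ (L : List A) b (t : A → Bool) → xorSum L (λ x → b ∧ t x) ≡ b ∧ xorSum L t
xorSum-∧ˡ []      false t = refl
xorSum-∧ˡ []      true  t = refl
xorSum-∧ˡ (x ∷ L) b     t = trans (cong ((b ∧ t x) xor_) (xorSum-∧ˡ L b t))
                                  (sym (∧-distribˡ-xor b (t x) (xorSum L t)))

xorSum-comm : ∀ (L : List A) (M : List B) (g : A → B → Bool) →
              xorSum L (λ x → xorSum M (g x)) ≡ xorSum M (λ y → xorSum L (λ x → g x y))
xorSum-comm []      M g = sym (xorSum-false M {λ _ → false} (λ _ → refl))
xorSum-comm (x ∷ L) M g = trans (cong (xorSum M (g x) xor_) (xorSum-comm L M g))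
                                (sym (xorSum-xor M (g x) (λ y → xorSum L (λ x → g x y))))

module _ (_≟_ : DecidableEquality A) where

  xorSum-indicator : ∀ {L} → Unique L → ∀ {x} → x ∈ L → xorSum L (λ y → ⌊ y ≟ x ⌋) ≡ true
  xorSum-indicator {x ∷ L} (x∉L ∷ _) (here refl) =
    cong₂ _xor_ (⌊⌋-true (x ≟ x) refl)
                (xorSum-false L (λ y∈L → ⌊⌋-false (_ ≟ x) (λ { refl → All.lookup x∉L y∈L refl })))
  xorSum-indicator {y ∷ L} (y∉L ∷ uL) {x} (there x∈L)
    rewrite ⌊⌋-false (y ≟ x) (λ { refl → All.lookup y∉L x∈L refl }) = xorSum-indicator uL x∈L

  xorSum-pick : ∀ {L} → Unique L → ∀ {x} → x ∈ L → ∀ (t : A → Bool) → xorSum L (λ y → ⌊ y ≟ x ⌋ ∧ t y) ≡ t x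
  xorSum-pick {L} uL {x} x∈L t = begin
    xorSum L (λ y → ⌊ y ≟ x ⌋ ∧ t y)  ≡⟨ xorSum-cong L (λ {y} _ → pick-pointwise y) ⟩
    xorSum L (λ y → ⌊ y ≟ x ⌋ ∧ t x)  ≡⟨ xorSum-∧ʳ L (λ y → ⌊ y ≟ x ⌋) (t x) ⟩
    xorSum L (λ y → ⌊ y ≟ x ⌋) ∧ t x  ≡⟨ cong (_∧ t x) (xorSum-indicator uL x∈L) ⟩
    t x                               ∎
    where
    open ≡-Reasoning
    pick-pointwise : ∀ y → ⌊ y ≟ x ⌋ ∧ t y ≡ ⌊ y ≟ x ⌋ ∧ t x
    pick-pointwise y with y ≟ x
    ... | yes refl = refl
    ... | no  _    = refl

_⋖_ : ∀ {n} → Subset n → Subset n → Set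
ρ ⋖ β = suc ∣ ρ ∣ ≡ ∣ β ∣ × ρ ⊆ β

_⋖²_ : ∀ {n} → Subset n → Subset n → Set
ρ ⋖² τ = suc (suc ∣ ρ ∣) ≡ ∣ τ ∣ × ρ ⊆ τ

⋖-trans² : ∀ {n} {ρ β τ : Subset n} → ρ ⋖ β → β ⋖ τ → ρ ⋖² τ
⋖-trans² (ρβ , ρ⊆β) (βτ , β⊆τ) = trans (cong suc ρβ) βτ , ⊆-trans ρ⊆β β⊆τ

⊆∧∣∣≡⇒≡ : ∀ {n} {p q : Subset n} → p ⊆ q → ∣ p ∣ ≡ ∣ q ∣ → p ≡ q
⊆∧∣∣≡⇒≡ {p = []}          {[]}          _   _ = refl
⊆∧∣∣≡⇒≡ {p = outside ∷ p} {outside ∷ q} p⊆q e = cong (outside ∷_) (⊆∧∣∣≡⇒≡ (drop-∷-⊆ p⊆q) e)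
⊆∧∣∣≡⇒≡ {p = outside ∷ p} {inside ∷ q}  p⊆q e =
  ⊥-elim (<-irrefl refl (subst (_≤ ∣ q ∣) e (p⊆q⇒∣p∣≤∣q∣ (drop-∷-⊆ p⊆q))))
⊆∧∣∣≡⇒≡ {p = inside ∷ p}  {outside ∷ q} p⊆q e with () ← p⊆q here
⊆∧∣∣≡⇒≡ {p = inside ∷ p}  {inside ∷ q}  p⊆q e =
  cong (inside ∷_) (⊆∧∣∣≡⇒≡ (drop-∷-⊆ p⊆q) (suc-injective e))

record Diamond {n} (ρ τ : Subset n) : Set where
  field
    left right : Subset n
    left≢right : left ≢ right
    ρ⋖left     : ρ ⋖ left
    left⋖τ     : left ⋖ τ
    ρ⋖right    : ρ ⋖ right
    right⋖τ    : right ⋖ τ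
    between    : ∀ {β} → ρ ⋖ β → β ⋖ τ → β ≡ left ⊎ β ≡ right

module _ {n} {ρ β : Subset n} where

  ⋖-∷ : ∀ b → ρ ⋖ β → (b ∷ ρ) ⋖ (b ∷ β)
  ⋖-∷ outside (e , ρ⊆β) = e , out⊆ ρ⊆β
  ⋖-∷ inside  (e , ρ⊆β) = cong suc e , in⊆in ρ⊆β

  ⋖-drop-∷ : ∀ {b} → (b ∷ ρ) ⋖ (b ∷ β) → ρ ⋖ β
  ⋖-drop-∷ {outside} (e , ρ⊆β) = e , drop-∷-⊆ ρ⊆β
  ⋖-drop-∷ {inside}  (e , ρ⊆β) = suc-injective e , drop-∷-⊆ ρ⊆β

⋖-⋖-head : ∀ {n} {ρ β τ : Subset n} {b c} → (b ∷ ρ) ⋖ (c ∷ β) → (c ∷ β) ⋖ (b ∷ τ) → c ≡ b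
⋖-⋖-head {b = outside} {outside} _ _ = refl
⋖-⋖-head {b = outside} {inside}  _ (_ , β⊆τ) with () ← β⊆τ here
⋖-⋖-head {b = inside}  {outside} (_ , ρ⊆β) _ with () ← ρ⊆β here
⋖-⋖-head {b = inside}  {inside}  _ _ = refl

Diamond-∷ : ∀ {n} {ρ τ : Subset n} b → Diamond ρ τ → Diamond (b ∷ ρ) (b ∷ τ)
Diamond-∷ b D = record
  { left       = b ∷ left
  ; right      = b ∷ right
  ; left≢right = left≢right ∘ ∷-injectiveʳ
  ; ρ⋖left     = ⋖-∷ b ρ⋖left
  ; left⋖τ     = ⋖-∷ b left⋖τ
  ; ρ⋖right    = ⋖-∷ b ρ⋖right
  ; right⋖τ    = ⋖-∷ b right⋖τ
  ; between    = between-∷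
  }
  where
  open Diamond D
  between-∷ : ∀ {β} → (b ∷ _) ⋖ β → β ⋖ (b ∷ _) → β ≡ b ∷ left ⊎ β ≡ b ∷ right
  between-∷ {c ∷ β} ρ⋖β β⋖τ with refl ← ⋖-⋖-head ρ⋖β β⋖τ =
    Sum.map (cong (b ∷_)) (cong (b ∷_)) (between (⋖-drop-∷ ρ⋖β) (⋖-drop-∷ β⋖τ))

diamond : ∀ {n} {ρ τ : Subset n} → ρ ⋖² τ → Diamond ρ τ
diamond {ρ = []}          {[]}          (() , _)
diamond {ρ = inside ∷ ρ}  {outside ∷ τ} (_ , ρ⊆τ) with () ← ρ⊆τ here
diamond {ρ = outside ∷ ρ} {outside ∷ τ} (e , ρ⊆τ) = Diamond-∷ outside (diamond (e , drop-∷-⊆ ρ⊆τ))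
diamond {ρ = inside ∷ ρ}  {inside ∷ τ}  (e , ρ⊆τ) =
  Diamond-∷ inside (diamond (suc-injective e , drop-∷-⊆ ρ⊆τ))
-- Here τ ∖ ρ is the head plus one more element, so the intermediate sets are ρ with the
-- head added and τ with the head removed.
diamond {ρ = outside ∷ ρ} {inside ∷ τ}  (e , ρ⊆τ) = record
  { left       = inside ∷ ρ
  ; right      = outside ∷ τ
  ; left≢right = λ ()
  ; ρ⋖left     = refl , out⊆ ⊆-refl
  ; left⋖τ     = e , in⊆in ρ'⊆τ
  ; ρ⋖right    = suc-injective e , out⊆ ρ'⊆τ
  ; right⋖τ    = refl , out⊆ ⊆-refl
  ; between    = between
  }
  where
  ρ'⊆τ : ρ ⊆ τ
  ρ'⊆τ = drop-∷-⊆ ρ⊆τ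
  between : ∀ {β} → (outside ∷ ρ) ⋖ β → β ⋖ (inside ∷ τ) → β ≡ inside ∷ ρ ⊎ β ≡ outside ∷ τ
  between {inside ∷ β}  (e′ , ρ⊆β) _ =
    inj₁ (cong (inside ∷_) (sym (⊆∧∣∣≡⇒≡ (drop-∷-⊆ ρ⊆β) (suc-injective e′))))
  between {outside ∷ β} _ (e′ , β⊆τ) =
    inj₂ (cong (outside ∷_) (⊆∧∣∣≡⇒≡ (drop-∷-⊆ β⊆τ) (suc-injective e′)))

module _ {n} (K : List (Simplex n)) where

  sumOver-cong : ∀ {c c′ : Chain n} → c ≐ c′ → ∀ f → sumOver K c f ≐ sumOver K c′ f
  sumOver-cong c≐c′ f ρ = xorSum-cong K (λ {σ} _ → cong (_∧ f σ ρ) (c≐c′ σ))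

  sumOver-zero : ∀ {c : Chain n} → c ≐ zeroC → ∀ f → sumOver K c f ≐ zeroC
  sumOver-zero c≐0 f ρ = xorSum-false K (λ {σ} _ → cong (_∧ f σ ρ) (c≐0 σ))

  sumOver-sumOver : ∀ (c : Chain n) f g →
                    sumOver K (sumOver K c f) g ≐ sumOver K c (λ σ → sumOver K (f σ) g)
  sumOver-sumOver c f g ρ = begin
    xorSum K (λ τ → xorSum K (λ σ → c σ ∧ f σ τ) ∧ g τ ρ)
      ≡⟨ xorSum-cong K (λ {τ} _ → sym (xorSum-∧ʳ K (λ σ → c σ ∧ f σ τ) (g τ ρ))) ⟩
    xorSum K (λ τ → xorSum K (λ σ → (c σ ∧ f σ τ) ∧ g τ ρ))
      ≡⟨ xorSum-comm K K (λ τ σ → (c σ ∧ f σ τ) ∧ g τ ρ) ⟩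
    xorSum K (λ σ → xorSum K (λ τ → (c σ ∧ f σ τ) ∧ g τ ρ))
      ≡⟨ xorSum-cong K (λ {σ} _ → xorSum-cong K (λ {τ} _ → ∧-assoc (c σ) (f σ τ) (g τ ρ))) ⟩
    xorSum K (λ σ → xorSum K (λ τ → c σ ∧ (f σ τ ∧ g τ ρ)))
      ≡⟨ xorSum-cong K (λ {σ} _ → xorSum-∧ˡ K (c σ) (λ τ → f σ τ ∧ g τ ρ)) ⟩
    xorSum K (λ σ → c σ ∧ xorSum K (λ τ → f σ τ ∧ g τ ρ))
      ∎
    where open ≡-Reasoning

  module _ (uniqueK : Unique K) {σ} (σ∈K : σ ∈ K) where

    sumOver-singleton : ∀ f → sumOver K (singleton σ) f ≐ f σ
    sumOver-singleton f ρ = xorSum-pick _≟S_ uniqueK σ∈K (λ β → f β ρ)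

    sumOver-remove : ∀ (c : Chain n) → c σ ≡ true →
                     ∀ f ρ → sumOver K c f ρ ≡ f σ ρ xor sumOver K (remove c σ) f ρ
    sumOver-remove c cσ f ρ = begin
      xorSum K (λ β → c β ∧ f β ρ)
        ≡⟨ xorSum-cong K (λ {β} _ → split β) ⟩
      xorSum K (λ β → (singleton σ β ∧ f β ρ) xor (remove c σ β ∧ f β ρ))
        ≡⟨ xorSum-xor K (λ β → singleton σ β ∧ f β ρ) (λ β → remove c σ β ∧ f β ρ) ⟩
      sumOver K (singleton σ) f ρ xor sumOver K (remove c σ) f ρ
        ≡⟨ cong (_xor sumOver K (remove c σ) f ρ) (sumOver-singleton f ρ) ⟩
      f σ ρ xor sumOver K (remove c σ) f ρ
        ∎
      where
      open ≡-Reasoning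
      split : ∀ β → c β ∧ f β ρ ≡ (singleton σ β ∧ f β ρ) xor (remove c σ β ∧ f β ρ)
      split β with β ≟S σ
      ... | yes refl rewrite cσ = sym (xor-identityʳ (f σ ρ))
      ... | no  _    = cong (_∧ f β ρ) (sym (∧-identityʳ (c β)))

remove≡true⇒ : ∀ {n} {c : Chain n} {σ β} → remove c σ β ≡ true → c β ≡ true × β ≢ σ
remove≡true⇒ {σ = σ} {β} e with ∧≡true⇒ e
... | cβ , β≢σ = cβ , not⌊⌋≡true⇒ (β ≟S σ) β≢σ

module _ {n} {K : List (Simplex n)} {τ β : Simplex n} where

  bd≡true⇒ : bd K τ β ≡ true → β ∈ K × β ⋖ τ
  bd≡true⇒ e with ∧≡true⇒ e
  ... | β∈K , e′ with ∧≡true⇒ e′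
  ... | size , β⊆τ =
    ⌊⌋≡true⇒ (β ∈? K) β∈K , ⌊⌋≡true⇒ (suc ∣ β ∣ ≟ℕ ∣ τ ∣) size , ⌊⌋≡true⇒ (β ⊆? τ) β⊆τ

  bd≡true⇐ : β ∈ K → β ⋖ τ → bd K τ β ≡ true
  bd≡true⇐ β∈K (size , β⊆τ) =
    cong₂ _∧_ (⌊⌋-true (β ∈? K) β∈K)
              (cong₂ _∧_ (⌊⌋-true (suc ∣ β ∣ ≟ℕ ∣ τ ∣) size) (⌊⌋-true (β ⊆? τ) β⊆τ))

∧-bd≡true⇒ : ∀ {n} {K : List (Simplex n)} {τ β ρ} → bd K τ β ∧ bd K β ρ ≡ true →
             (β ∈ K × β ⋖ τ) × (ρ ∈ K × ρ ⋖ β)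
∧-bd≡true⇒ e = Product.map bd≡true⇒ bd≡true⇒ (∧≡true⇒ e)

module _ {n} {K : List (Simplex n)} (complexK : IsComplex K) where

  private
    uniqueK : Unique K
    uniqueK = proj₁ complexK

    nonemptyK : ∀ {σ} → σ ∈ K → Nonempty σ
    nonemptyK = proj₁ (proj₂ complexK)

    closedK : ∀ {σ τ} → τ ∈ K → Nonempty σ → σ ⊆ τ → σ ∈ K
    closedK = proj₂ (proj₂ complexK)

  module _ {ρ τ} (τ∈K : τ ∈ K) (ρ∈K : ρ ∈ K) (D : Diamond ρ τ) where
    open Diamond D

    private
      left∈K : left ∈ K
      left∈K = closedK τ∈K (Product.map₂ (proj₂ ρ⋖left) (nonemptyK ρ∈K)) (proj₂ left⋖τ)

      right∈K : right ∈ K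
      right∈K = closedK τ∈K (Product.map₂ (proj₂ ρ⋖right) (nonemptyK ρ∈K)) (proj₂ right⋖τ)

    bd-bd-diamond : ∀ β → bd K τ β ∧ bd K β ρ ≡ ⌊ β ≟S left ⌋ xor ⌊ β ≟S right ⌋
    bd-bd-diamond β with β ≟S left | β ≟S right
    ... | yes p    | yes q    = ⊥-elim (left≢right (trans (sym p) q))
    ... | yes refl | no _     = cong₂ _∧_ (bd≡true⇐ left∈K left⋖τ) (bd≡true⇐ ρ∈K ρ⋖left)
    ... | no _     | yes refl = cong₂ _∧_ (bd≡true⇐ right∈K right⋖τ) (bd≡true⇐ ρ∈K ρ⋖right)
    ... | no β≢l   | no β≢r   = ¬-not λ term →
      let (_ , β⋖τ) , (_ , ρ⋖β) = ∧-bd≡true⇒ {K = K} term in [ β≢l , β≢r ] (between ρ⋖β β⋖τ)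

    bd-bd-at-diamond : bdC K (bd K τ) ρ ≡ false
    bd-bd-at-diamond = begin
      xorSum K (λ β → bd K τ β ∧ bd K β ρ)
        ≡⟨ xorSum-cong K (λ {β} _ → bd-bd-diamond β) ⟩
      xorSum K (λ β → ⌊ β ≟S left ⌋ xor ⌊ β ≟S right ⌋)
        ≡⟨ xorSum-xor K (λ β → ⌊ β ≟S left ⌋) (λ β → ⌊ β ≟S right ⌋) ⟩
      xorSum K (λ β → ⌊ β ≟S left ⌋) xor xorSum K (λ β → ⌊ β ≟S right ⌋)
        ≡⟨ cong₂ _xor_ (xorSum-indicator _≟S_ uniqueK left∈K) (xorSum-indicator _≟S_ uniqueK right∈K) ⟩
      true xor true
        ∎
      where open ≡-Reasoning

  bd-bd : ∀ {τ} → τ ∈ K → bdC K (bd K τ) ≐ zeroC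
  bd-bd {τ} τ∈K ρ with (ρ ∈? K) ×-dec ((suc (suc ∣ ρ ∣) ≟ℕ ∣ τ ∣) ×-dec (ρ ⊆? τ))
  ... | yes (ρ∈K , ρ⋖²τ) = bd-bd-at-diamond τ∈K ρ∈K (diamond ρ⋖²τ)
  ... | no ¬ρ⋖²τ         = xorSum-false K λ _ → ¬-not λ term →
    let (_ , β⋖τ) , (ρ∈K , ρ⋖β) = ∧-bd≡true⇒ {K = K} term in ¬ρ⋖²τ (ρ∈K , ⋖-trans² ρ⋖β β⋖τ)

MorseSeq⇒IsComplex : ∀ {n} {ss : List (Step n)} {K} → MorseSeq ss K → IsComplex K
MorseSeq⇒IsComplex start                               = [] , (λ ()) , (λ ())
MorseSeq⇒IsComplex (step _ _ (fillOK complex _ _))     = complex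
MorseSeq⇒IsComplex (step _ _ (expandOK complex _ _ _)) = complex

earlier-face : ∀ {n} {σ τ β : Simplex n} {L} → IsComplex (σ ∷ τ ∷ L) →
               Nonempty β → β ⋖ τ → β ≢ σ → β ∈ L
earlier-face (_ , _ , closed) β≠∅ (size , β⊆τ) β≢σ with closed (there (here refl)) β≠∅ β⊆τ
... | here β≡σ          = ⊥-elim (β≢σ β≡σ)
... | there (here refl) = ⊥-elim (1+n≢n size)
... | there (there β∈L) = β∈L

module MorseReference {n} {ss : List (Step n)} {K : List (Simplex n)} (ms : MorseSeq ss K)
                      (Υ : Simplex n → Chain n) (ref : IsMorseReference ss K Υ) where

  private
    complexK : IsComplex K
    complexK = MorseSeq⇒IsComplex ms

    uniqueK : Unique K
    uniqueK = proj₁ complexK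

    nonemptyK : ∀ {σ} → σ ∈ K → Nonempty σ
    nonemptyK = proj₁ (proj₂ complexK)

    Υ-critical : ∀ σ → Critical ss σ → Υ σ ≐ singleton σ
    Υ-critical = proj₁ (proj₂ ref)

    Υ-regular : ∀ σ τ → RegularPair ss σ τ →
                (Υ τ ≐ zeroC) × (Υ σ ≐ extend K Υ (remove (bd K τ) σ))
    Υ-regular = proj₂ (proj₂ ref)

  Υ∂ : Simplex n → Chain n
  Υ∂ σ = extend K Υ (bd K σ)

  Commutes : Simplex n → Set
  Commutes σ = dMorse ss K Υ (Υ σ) ≐ Υ∂ σ

  dMorse-extend : ∀ c → (∀ {σ} → σ ∈ K → c σ ≡ true → Commutes σ) →
                  dMorse ss K Υ (extend K Υ c) ≐ sumOver K c Υ∂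
  dMorse-extend c commutes ρ = trans (sumOver-sumOver K c Υ Υ∂ ρ) (xorSum-cong K pointwise)
    where
    pointwise : ∀ {σ} → σ ∈ K → c σ ∧ dMorse ss K Υ (Υ σ) ρ ≡ c σ ∧ Υ∂ σ ρ
    pointwise {σ} σ∈K with c σ in cσ
    ... | false = refl
    ... | true  = commutes σ∈K cσ ρ

  commutes-critical : ∀ {σ} → Critical ss σ → σ ∈ K → Commutes σ
  commutes-critical {σ} critical σ∈K ρ =
    trans (sumOver-cong K (Υ-critical σ critical) Υ∂ ρ) (sumOver-singleton K uniqueK σ∈K Υ∂ ρ)

  module _ {σ τ} (regular : RegularPair ss σ τ) (σ∈K : σ ∈ K) (σ⋖τ : σ ⋖ τ) where

    private
      ∂τ-σ : Chain n
      ∂τ-σ = remove (bd K τ) σ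

      Υτ≐0 : Υ τ ≐ zeroC
      Υτ≐0 = proj₁ (Υ-regular σ τ regular)

      Υσ≐Υ[∂τ-σ] : Υ σ ≐ extend K Υ ∂τ-σ
      Υσ≐Υ[∂τ-σ] = proj₂ (Υ-regular σ τ regular)

      split : ∀ f ρ → sumOver K (bd K τ) f ρ ≡ f σ ρ xor sumOver K ∂τ-σ f ρ
      split = sumOver-remove K uniqueK σ∈K (bd K τ) (bd≡true⇐ σ∈K σ⋖τ)

    commutes-upper : Commutes τ
    commutes-upper ρ = begin
      dMorse ss K Υ (Υ τ) ρ             ≡⟨ sumOver-zero K Υτ≐0 Υ∂ ρ ⟩
      false                             ≡⟨ xor-same (Υ σ ρ) ⟨
      Υ σ ρ xor Υ σ ρ                   ≡⟨ cong (Υ σ ρ xor_) (Υσ≐Υ[∂τ-σ] ρ) ⟩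
      Υ σ ρ xor extend K Υ ∂τ-σ ρ       ≡⟨ split Υ ρ ⟨
      Υ∂ τ ρ                            ∎
      where open ≡-Reasoning

    commutes-lower : τ ∈ K → (∀ {β} → ∂τ-σ β ≡ true → Commutes β) → Commutes σ
    commutes-lower τ∈K commutes-faces ρ = begin
      dMorse ss K Υ (Υ σ) ρ                  ≡⟨ sumOver-cong K Υσ≐Υ[∂τ-σ] Υ∂ ρ ⟩
      dMorse ss K Υ (extend K Υ ∂τ-σ) ρ      ≡⟨ dMorse-extend ∂τ-σ (λ _ → commutes-faces) ρ ⟩
      sumOver K ∂τ-σ Υ∂ ρ                    ≡⟨ xor≡false⇒≡ Υ∂∂τ≡0 ⟨
      Υ∂ σ ρ                                 ∎
      where
      open ≡-Reasoning
      Υ∂∂τ≡0 : Υ∂ σ ρ xor sumOver K ∂τ-σ Υ∂ ρ ≡ false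
      Υ∂∂τ≡0 = begin
        Υ∂ σ ρ xor sumOver K ∂τ-σ Υ∂ ρ       ≡⟨ split Υ∂ ρ ⟨
        sumOver K (bd K τ) Υ∂ ρ              ≡⟨ sumOver-sumOver K (bd K τ) (bd K) Υ ρ ⟨
        extend K Υ (bdC K (bd K τ)) ρ        ≡⟨ sumOver-zero K (bd-bd complexK τ∈K) Υ ρ ⟩
        false                                ∎

  commutes-along : ∀ {ss′ L} → MorseSeq ss′ L → ss′ List.⊆ ss → L List.⊆ K →
                   ∀ {σ} → σ ∈ L → Commutes σ
  commutes-along (step _ ms′ (fillOK _ _ _)) ss′⊆ss L⊆K (here refl) =
    commutes-critical (ss′⊆ss (here refl)) (L⊆K (here refl))
  commutes-along (step _ ms′ (fillOK _ _ _)) ss′⊆ss L⊆K (there σ∈L) =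
    commutes-along ms′ (ss′⊆ss ∘ there) (L⊆K ∘ there) σ∈L
  commutes-along (step {L = L′} _ ms′ (expandOK {σ} {τ} complex _ _ (_ , _ , size , σ⊂τ , _)))
                 ss′⊆ss L⊆K =
    commutes-step
    where
    σ⋖τ : σ ⋖ τ
    σ⋖τ = sym size , proj₁ σ⊂τ

    regular : RegularPair ss σ τ
    regular = ss′⊆ss (here refl)

    earlier : ∀ {β} → β ∈ L′ → Commutes β
    earlier = commutes-along ms′ (ss′⊆ss ∘ there) (L⊆K ∘ there ∘ there)

    faces : ∀ {β} → remove (bd K τ) σ β ≡ true → Commutes β
    faces r with β∈∂τ , β≢σ ← remove≡true⇒ {c = bd K τ} r
            with β∈K , β⋖τ ← bd≡true⇒ {K = K} β∈∂τ =
      earlier (earlier-face complex (nonemptyK β∈K) β⋖τ β≢σ)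

    commutes-step : ∀ {β} → β ∈ σ ∷ τ ∷ L′ → Commutes β
    commutes-step (here refl)         =
      commutes-lower regular (L⊆K (here refl)) σ⋖τ (L⊆K (there (here refl))) faces
    commutes-step (there (here refl)) = commutes-upper regular (L⊆K (here refl)) σ⋖τ
    commutes-step (there (there β∈L)) = earlier β∈L

  commutes : ∀ {σ} → σ ∈ K → Commutes σ
  commutes = commutes-along ms id id

theorem2 : ∀ {n} (ss : List (Step n)) (K : List (Simplex n))
    → MorseSeq ss K
    → (Υ : Simplex n → Chain n) → IsMorseReference ss K Υ
    → (p : ℕ) (c : Chain n) → InChains K p c
    → dMorse ss K Υ (extend K Υ c) ≐ extend K Υ (bdC K c)
theorem2 ss K ms Υ ref _ c _ ρ = begin
  dMorse ss K Υ (extend K Υ c) ρ   ≡⟨ dMorse-extend c (λ σ∈K _ → commutes σ∈K) ρ ⟩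
  sumOver K c Υ∂ ρ                 ≡⟨ sumOver-sumOver K c (bd K) Υ ρ ⟨
  extend K Υ (bdC K c) ρ           ∎
  where
  open MorseReference ms Υ ref
  open ≡-Reasoning
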